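{- Let $G=(V,E)$ be a finite undirected graph and $s>1$. Consider the procedure: orient every edge of $E$ arbitrarily, obtaining $\vec E$; then, while there exists $(u,v)\in\vec E$ with $d^{\mathrm{out}}(u)\ge s$ and $d^{\mathrm{out}}(v)<s-1$, reverse the direction of $(u,v)$; finally return $\vec G=(V,\vec E)$. This procedure terminates, and the returned $\vec G$ satisfies: for every $(u,v)\in\vec E$, $d^{\mathrm{out}}(u)<s$ or $d^{\mathrm{out}}(v)\ge s-1$.
   Context: $d^{\mathrm{out}}(u)=|\{v:(u,v)\in\vec E\}|$ denotes the unweighted out-degree of $u$ in the current orientation $\vec E$. -}

module Defs where

open import Data.Nat using (ℕ; zero; suc; _+_; _≤_; _<_; _∸_)
open import Data.Bool using (Bool; true; false; not; if_then_else_)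
open import Data.Fin using (Fin; _≟_)
open import Data.Fin.Properties using ()
open import Data.Product using (_×_; _,_; proj₁; proj₂; Σ; swap)
open import Data.Sum using (_⊎_)
open import Data.Vec using (Vec; []; _∷_; lookup; _[_]%=_)
open import Relation.Nullary using (¬_; does)
open import Relation.Binary.PropositionalEquality using (_≡_)

-- A finite undirected graph on vertex set Fin n with m edges,
-- each edge given by its two endpoints (listed in an arbitrary order).
Edge : ℕ → Set
Edge n = Fin n × Fin n

Simple : ∀ {n m} → Vec (Edge n) m → Set
Simple {n} {m} E =
  (∀ i → ¬ (proj₁ (lookup E i) ≡ proj₂ (lookup E i))) ×
  (∀ i j → (lookup E i ≡ lookup E j ⊎ lookup E i ≡ swap (lookup E j)) → i ≡ j)

-- An orientation of E: one bit per edge (true = as listed, false = reversed).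
Orientation : ℕ → Set
Orientation m = Vec Bool m

orient : ∀ {n} → Edge n → Bool → Edge n
orient e true  = e
orient e false = swap e

arc : ∀ {n m} → Vec (Edge n) m → Orientation m → Fin m → Edge n
arc E o i = orient (lookup E i) (lookup o i)

outdeg : ∀ {n m} → Vec (Edge n) m → Orientation m → Fin n → ℕ
outdeg []       []       u = 0
outdeg (e ∷ E) (b ∷ o) u =
  (if does (proj₁ (orient e b) ≟ u) then 1 else 0) + outdeg E o u

Step : ∀ {n m} → Vec (Edge n) m → ℕ → Orientation m → Orientation m → Set
Step {n} {m} E s o o' =
  Σ (Fin m) λ i →
    (s ≤ outdeg E o (proj₁ (arc E o i))) ×
    (outdeg E o (proj₂ (arc E o i)) < s ∸ 1) ×
    (o' ≡ (o [ i ]%= not))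

module Submission where

-- Write d = outdeg E o.  Reversing the arc (a , b) moves exactly one unit of
-- out-degree from its tail a to its head b; as an identity between Kronecker
-- deltas,  d' u + δ a u ≡ d u + δ b u  for every vertex u.  Since
-- (x + δ)² = x² + δ (2x + 1) for a 0/1-valued δ, summing the squares of both
-- sides over all vertices gives for the load  Φ = ∑ᵤ d u²  the identity
--     Φ' + (2 d' a + 1) ≡ Φ + (2 d b + 1).
-- A step of the procedure reverses an arc with d a ≥ s > d b + 1, and then
-- d' a + 1 ≥ d a forces d' a > d b, so Φ strictly decreases.  Hence the
-- converse of the step relation is well founded (every run terminates), by
-- pulling back the well-foundedness of _<_ on ℕ along Φ.  Correctness is the
-- loop-exit condition: in an orientation admitting no step, every arc
-- violates one of the two guard conditions.

open import Defs
open import Data.Nat using (ℕ; suc; _+_; _*_; _<_; _≤_; _∸_; s≤s; s≤s⁻¹; _<?_; _≤?_)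
open import Data.Nat.Properties
  using (+-assoc; +-comm; +-identityʳ; +-0-commutativeMonoid; m≤m+n; ≤-trans; <-≤-trans; +-monoʳ-<;
         +-monoˡ-<; *-monoʳ-<; +-cancelʳ-<; ≮⇒≥; ≰⇒>; ≤-reflexive; module ≤-Reasoning)
open import Data.Nat.Solver using (module +-*-Solver)
open import Data.Fin using (Fin; _≟_) renaming (zero to fzero; suc to fsuc)
open import Data.Bool using (Bool; true; false; not; if_then_else_)
open import Data.Vec using (Vec; _∷_; _[_]%=_)
open import Function using (_∘_)
open import Data.Product using (_×_; _,_; proj₁; proj₂)
open import Data.Sum using (_⊎_; inj₁; inj₂)
open import Relation.Nullary using (¬_; does; yes; no; contradiction)
open import Relation.Binary.PropositionalEquality using (_≡_; refl; trans; cong; cong₂; module ≡-Reasoning)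
open import Data.Nat.Induction using (<-wellFounded)
open import Induction.WellFounded using (Acc; module Subrelation)
open import Relation.Binary.Construct.On using (accessible)
open import Relation.Binary.Construct.Closure.ReflexiveTransitive using (Star)
open import Algebra.Properties.CommutativeMonoid.Sum +-0-commutativeMonoid
  using (sum-syntax; ∑-distrib-+; sum-cong-≗; sum-replicate-zero)

open +-*-Solver using (solve; _:+_; _:*_; _:=_; con)

bit : Bool → ℕ
bit p = if p then 1 else 0

-- The Kronecker delta on vertices; this is exactly the summand by which
-- outdeg counts an arc with tail x towards the out-degree of u.
δ : ∀ {n} → Fin n → Fin n → ℕ
δ x u = bit (does (x ≟ u))

δ-diagonal : ∀ {n} (x : Fin n) → δ x x ≡ 1
δ-diagonal x with x ≟ x
... | yes _  = refl
... | no x≢x = contradiction refl x≢x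

∑-δ-select : ∀ {n} (a : Fin n) (f : Fin n → ℕ) → ∑[ u < n ] (δ a u * f u) ≡ f a
∑-δ-select {suc n} fzero    f =
  trans (cong₂ _+_ (+-identityʳ (f fzero)) (sum-replicate-zero n)) (+-identityʳ (f fzero))
∑-δ-select {suc n} (fsuc a) f = ∑-δ-select a (f ∘ fsuc)

square-shift : ∀ x (p : Bool) → (x + bit p) * (x + bit p) ≡ x * x + bit p * (2 * x + 1)
square-shift x true  = solve 1 (λ x → (x :+ con 1) :* (x :+ con 1) := x :* x :+ con 1 :* (con 2 :* x :+ con 1)) refl x
square-shift x false = solve 1 (λ x → (x :+ con 0) :* (x :+ con 0) := x :* x :+ con 0 :* (con 2 :* x :+ con 1)) refl x

swap-ends : ∀ p r q → p + r + q ≡ q + r + p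
swap-ends = solve 3 (λ p r q → p :+ r :+ q := q :+ r :+ p) refl

reverse-transfers : ∀ {n m} (E : Vec (Edge n) m) (o : Orientation m) (i : Fin m) (u : Fin n) →
  outdeg E (o [ i ]%= not) u + δ (proj₁ (arc E o i)) u ≡ outdeg E o u + δ (proj₂ (arc E o i)) u
reverse-transfers ((x , y) ∷ E) (true  ∷ o) fzero u = swap-ends (δ y u) (outdeg E o u) (δ x u)
reverse-transfers ((x , y) ∷ E) (false ∷ o) fzero u = swap-ends (δ x u) (outdeg E o u) (δ y u)
reverse-transfers (e ∷ E) (b ∷ o) (fsuc i) u = begin
  t + outdeg E (o [ i ]%= not) u + δ (proj₁ (arc E o i)) u  ≡⟨ +-assoc t _ _ ⟩
  t + (outdeg E (o [ i ]%= not) u + δ (proj₁ (arc E o i)) u) ≡⟨ cong (t +_) (reverse-transfers E o i u) ⟩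
  t + (outdeg E o u + δ (proj₂ (arc E o i)) u)              ≡⟨ +-assoc t _ _ ⟨
  t + outdeg E o u + δ (proj₂ (arc E o i)) u                ∎
  where
  open ≡-Reasoning
  t = δ (proj₁ (orient e b)) u

squares-transfer : ∀ {n} (d d' : Fin n → ℕ) (a b : Fin n) →
  (∀ u → d' u + δ a u ≡ d u + δ b u) →
  ∑[ u < n ] (d' u * d' u) + (2 * d' a + 1) ≡ ∑[ u < n ] (d u * d u) + (2 * d b + 1)
squares-transfer {n} d d' a b transfer = begin
  ∑[ u < n ] (d' u * d' u) + (2 * d' a + 1)
    ≡⟨ cong (∑[ u < n ] (d' u * d' u) +_) (∑-δ-select a (λ u → 2 * d' u + 1)) ⟨
  ∑[ u < n ] (d' u * d' u) + ∑[ u < n ] (δ a u * (2 * d' u + 1))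
    ≡⟨ ∑-distrib-+ (λ u → d' u * d' u) (λ u → δ a u * (2 * d' u + 1)) ⟨
  ∑[ u < n ] (d' u * d' u + δ a u * (2 * d' u + 1))
    ≡⟨ sum-cong-≗ (λ u → square-shift (d' u) (does (a ≟ u))) ⟨
  ∑[ u < n ] ((d' u + δ a u) * (d' u + δ a u))
    ≡⟨ sum-cong-≗ (λ u → cong (λ x → x * x) (transfer u)) ⟩
  ∑[ u < n ] ((d u + δ b u) * (d u + δ b u))
    ≡⟨ sum-cong-≗ (λ u → square-shift (d u) (does (b ≟ u))) ⟩
  ∑[ u < n ] (d u * d u + δ b u * (2 * d u + 1))
    ≡⟨ ∑-distrib-+ (λ u → d u * d u) (λ u → δ b u * (2 * d u + 1)) ⟩
  ∑[ u < n ] (d u * d u) + ∑[ u < n ] (δ b u * (2 * d u + 1))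
    ≡⟨ cong (∑[ u < n ] (d u * d u) +_) (∑-δ-select b (λ u → 2 * d u + 1)) ⟩
  ∑[ u < n ] (d u * d u) + (2 * d b + 1) ∎
  where open ≡-Reasoning

source-after-transfer : ∀ {n} (d d' : Fin n → ℕ) (a b : Fin n) →
  (∀ u → d' u + δ a u ≡ d u + δ b u) → d a ≤ suc (d' a)
source-after-transfer d d' a b transfer = ≤-trans (m≤m+n (d a) (δ b a)) (≤-reflexive (begin
  d a + δ b a   ≡⟨ transfer a ⟨
  d' a + δ a a  ≡⟨ cong (d' a +_) (δ-diagonal a) ⟩
  d' a + 1      ≡⟨ +-comm (d' a) 1 ⟩
  suc (d' a)    ∎))
  where open ≡-Reasoning

squares-decrease : ∀ {n} (d d' : Fin n → ℕ) (a b : Fin n) →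
  (∀ u → d' u + δ a u ≡ d u + δ b u) → suc (d b) < d a →
  ∑[ u < n ] (d' u * d' u) < ∑[ u < n ] (d u * d u)
squares-decrease {n} d d' a b transfer gap =
  +-cancelʳ-< _ _ _ (begin-strict
    ∑[ u < n ] (d' u * d' u) + (2 * d' a + 1)  ≡⟨ squares-transfer d d' a b transfer ⟩
    ∑[ u < n ] (d u * d u) + (2 * d b + 1)      <⟨ +-monoʳ-< (∑[ u < n ] (d u * d u)) (+-monoˡ-< 1 (*-monoʳ-< 2 target<new-source)) ⟩
    ∑[ u < n ] (d u * d u) + (2 * d' a + 1)     ∎)
  where
  open ≤-Reasoning
  target<new-source : d b < d' a
  target<new-source = s≤s⁻¹ (<-≤-trans gap (source-after-transfer d d' a b transfer))

load : ∀ {n m} → Vec (Edge n) m → Orientation m → ℕ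
load {n} E o = ∑[ u < n ] (outdeg E o u * outdeg E o u)

guard-gap : ∀ {x y} s → s ≤ x → y < s ∸ 1 → suc y < x
guard-gap (suc s) s≤x y<s-1 = <-≤-trans (s≤s y<s-1) s≤x

step-decreases-load : ∀ {n m} (E : Vec (Edge n) m) (s : ℕ) {o o' : Orientation m} →
  Step E s o o' → load E o' < load E o
step-decreases-load E s {o} (i , tail-heavy , head-light , refl) =
  squares-decrease (outdeg E o) (outdeg E (o [ i ]%= not)) (proj₁ (arc E o i)) (proj₂ (arc E o i))
    (reverse-transfers E o i) (guard-gap s tail-heavy head-light)

-- Hence the procedure terminates from every orientation: the converse of
-- the step relation is well founded, as the pull-back of _<_ along load.
step-terminates : ∀ {n m} (E : Vec (Edge n) m) (s : ℕ) (o : Orientation m) →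
  Acc (λ o₂ o₁ → Step E s o₁ o₂) o
step-terminates E s o =
  Subrelation.accessible (step-decreases-load E s) (accessible (load E) (<-wellFounded (load E o)))

terminal-balanced : ∀ {n m} (E : Vec (Edge n) m) (s : ℕ) (o : Orientation m) →
  (∀ o' → ¬ Step E s o o') → ∀ (i : Fin m) →
  outdeg E o (proj₁ (arc E o i)) < s ⊎ s ∸ 1 ≤ outdeg E o (proj₂ (arc E o i))
terminal-balanced E s o no-step i with outdeg E o (proj₁ (arc E o i)) <? s
... | yes tail-light = inj₁ tail-light
... | no tail-heavy with s ∸ 1 ≤? outdeg E o (proj₂ (arc E o i))
...   | yes head-heavy = inj₂ head-heavy
...   | no head-light  = contradiction (i , ≮⇒≥ tail-heavy , ≰⇒> head-light , refl) (no-step _)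

lemma7 : ∀ {n m} (E : Vec (Edge n) m) (s : ℕ) → Simple E → 1 < s →
         (∀ (o : Orientation m) → Acc (λ o₂ o₁ → Step E s o₁ o₂) o) ×
         (∀ (o o' : Orientation m) → Star (Step E s) o o' →
            (∀ o'' → ¬ Step E s o' o'') →
            ∀ (i : Fin m) →
              outdeg E o' (proj₁ (arc E o' i)) < s ⊎
              s ∸ 1 ≤ outdeg E o' (proj₂ (arc E o' i)))
lemma7 E s _ _ = step-terminates E s , λ _ o' _ → terminal-balanced E s o'
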